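{- For every integer $n\ge 3$, $|B_n(213,312,321)|=n$.
   Context: A permutation $\sigma\in S_n$ is written as $\sigma(1)\cdots\sigma(n)$. An index $i\in[n-1]$ is an ascent if $\sigma(i)<\sigma(i+1)$ and a descent if $\sigma(i)>\sigma(i+1)$. A ballot permutation is a permutation such that every prefix $\sigma(1)\cdots\sigma(p)$ has at least as many ascents as descents. $\sigma$ contains a pattern $\pi\in S_k$ if some subsequence $\sigma(c_1)\cdots\sigma(c_k)$ with $c_1<\dots<c_k$ is order-isomorphic to $\pi$, and avoids $\pi$ otherwise. $B_n(\pi_1,\dots,\pi_m)$ denotes the set of ballot permutations of length $n$ avoiding all of $\pi_1,\dots,\pi_m$. -}

module Defs where

open import Data.Nat using (ℕ; zero; suc; _≤_; _<_; _+_)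
open import Data.Fin using (Fin; toℕ) renaming (_<_ to _<ᶠ_)
open import Data.Vec using (Vec; []; _∷_; lookup)
open import Data.List using (List; length)
open import Data.List.Membership.Propositional using (_∈_)
open import Data.List.Relation.Unary.Unique.Propositional using (Unique)
open import Data.Product using (Σ; _×_; ∃)
open import Relation.Binary.PropositionalEquality using (_≡_)
open import Relation.Nullary using (¬_)
open import Function using (_⇔_)

-- A word σ(1)⋯σ(n) over Fin n in one-line notation, stored as a vector.
-- It is a permutation of length n iff its entries are pairwise distinct.
IsPerm : {n : ℕ} → Vec (Fin n) n → Set
IsPerm {n} σ = ∀ (i j : Fin n) → lookup σ i ≡ lookup σ j → i ≡ j

lt : ℕ → ℕ → ℕ
lt x y with Data.Nat._<?_ x y
... | Relation.Nullary.yes _ = 1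
... | Relation.Nullary.no  _ = 0

ascFrom : ℕ → List ℕ → ℕ
ascFrom x List.[] = 0
ascFrom x (y List.∷ ys) = lt x y + ascFrom y ys

desFrom : ℕ → List ℕ → ℕ
desFrom x List.[] = 0
desFrom x (y List.∷ ys) = lt y x + desFrom y ys

asc : List ℕ → ℕ
asc List.[] = 0
asc (x List.∷ xs) = ascFrom x xs

des : List ℕ → ℕ
des List.[] = 0
des (x List.∷ xs) = desFrom x xs

-- One-line notation as a list of naturals (values shifted to 0-based; order
-- is all that matters).
toList : {n m : ℕ} → Vec (Fin m) n → List ℕ
toList [] = List.[]
toList (x ∷ xs) = toℕ x List.∷ toList xs

IsBallot : {n : ℕ} → Vec (Fin n) n → Set
IsBallot σ = ∀ (p : ℕ) → des (Data.List.take p (toList σ)) ≤ asc (Data.List.take p (toList σ))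

Contains : {n k : ℕ} → Vec (Fin n) n → Vec (Fin k) k → Set
Contains {n} {k} σ π =
  Σ (Fin k → Fin n) λ c →
    (∀ (a b : Fin k) → a <ᶠ b → c a <ᶠ c b) ×
    (∀ (a b : Fin k) → (lookup σ (c a) <ᶠ lookup σ (c b)) ⇔ (lookup π a <ᶠ lookup π b))

Avoids : {n k : ℕ} → Vec (Fin n) n → Vec (Fin k) k → Set
Avoids σ π = ¬ Contains σ π

p213 p312 p321 : Vec (Fin 3) 3
p213 = Data.Fin.suc Data.Fin.zero ∷ Data.Fin.zero ∷ Data.Fin.suc (Data.Fin.suc Data.Fin.zero) ∷ []
p312 = Data.Fin.suc (Data.Fin.suc Data.Fin.zero) ∷ Data.Fin.zero ∷ Data.Fin.suc Data.Fin.zero ∷ []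
p321 = Data.Fin.suc (Data.Fin.suc Data.Fin.zero) ∷ Data.Fin.suc Data.Fin.zero ∷ Data.Fin.zero ∷ []

InB : (n : ℕ) → Vec (Fin n) n → Set
InB n σ = IsPerm σ × IsBallot σ × Avoids σ p213 × Avoids σ p312 × Avoids σ p321

HasCard : {A : Set} → (A → Set) → ℕ → Set
HasCard {A} S m = Σ (List A) λ L → Unique L × length L ≡ m × (∀ x → (x ∈ L) ⇔ S x)

module Submission where

-- The three patterns are exactly the patterns of length 3 that start with a descent.  So σ avoids
-- them iff σ(i) < σ(j) whenever i < j < l for some position l, i.e. iff σ(1) < ⋯ < σ(n-1).  Such a
-- permutation is determined by its last value k: it lists [n] ∖ {k} increasingly and then k.  For
-- n ≥ 3 each of these n permutations is ballot, since its only possible descent is the final one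
-- and it starts with an ascent.

open import Defs
open import Data.Nat using (ℕ; _≤_; zero; suc; _+_; _∸_; _<_; z≤n; s≤s; _<?_)
open import Data.Nat.Properties
open import Data.Fin as Fin using (Fin; toℕ; fromℕ; fromℕ<) renaming (_<_ to _<ᶠ_)
import Data.Fin.Properties as Finₚ
open import Data.Vec using (Vec; []; _∷_; lookup; tabulate)
open import Data.Vec.Properties using (lookup∘tabulate; tabulate∘lookup; tabulate-cong)
open import Data.List using (map; allFin; take)
open import Data.List.Properties using (length-map; length-tabulate; take-[])
open import Data.List.Membership.Propositional using (_∈_)
open import Data.List.Membership.Propositional.Properties using (∈-map⁺; ∈-map⁻; ∈-allFin)
open import Data.List.Relation.Unary.Unique.Propositional.Properties using (map⁺; allFin⁺)
open import Data.Product using (_,_)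
open import Data.Sum using (_⊎_; inj₁; inj₂)
open import Data.Empty using (⊥-elim)
open import Relation.Nullary using (yes; no)
open import Relation.Binary.Core using (Rel; _Preserves_⟶_)
open import Relation.Binary.Definitions using (Transitive; tri<; tri≈; tri>)
open import Relation.Binary.PropositionalEquality
open import Function using (_∘_; mk⇔; Equivalence)

pattern 0F = Fin.zero
pattern 1F = Fin.suc 0F
pattern 2F = Fin.suc 1F

lt-< : ∀ {x y} → x < y → lt x y ≡ 1
lt-< {x} {y} x<y with x <? y
... | yes _   = refl
... | no x≮y = ⊥-elim (x≮y x<y)

lt-≥ : ∀ {x y} → y ≤ x → lt x y ≡ 0
lt-≥ {x} {y} y≤x with x <? y
... | yes x<y = ⊥-elim (<⇒≱ x<y y≤x)
... | no _    = refl

lt≤1 : ∀ x y → lt x y ≤ 1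
lt≤1 x y with x <? y
... | yes _ = ≤-refl
... | no _  = z≤n

IncreasingButLast : ∀ {m n} → Vec (Fin m) n → Set
IncreasingButLast {n = n} σ = ∀ {i j l : Fin n} → i <ᶠ j → j <ᶠ l → lookup σ i <ᶠ lookup σ j

increasingButLast-tail : ∀ {m n} {x : Fin m} {xs : Vec (Fin m) n} →
                         IncreasingButLast (x ∷ xs) → IncreasingButLast xs
increasingButLast-tail inc {i} {j} {l} i<j j<l =
  inc {Fin.suc i} {Fin.suc j} {Fin.suc l} (s≤s i<j) (s≤s j<l)

increasingButLast-head : ∀ {m n} {x y z : Fin m} {xs : Vec (Fin m) n} →
                         IncreasingButLast (x ∷ y ∷ z ∷ xs) → x <ᶠ y
increasingButLast-head inc =
  inc {0F} {1F} {2F} (s≤s z≤n) (s≤s (s≤s z≤n))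

desFrom-take-≤1 : ∀ {m n} {x : Fin m} {xs : Vec (Fin m) n} → IncreasingButLast (x ∷ xs) →
                  ∀ q → desFrom (toℕ x) (take q (toList xs)) ≤ 1
desFrom-take-≤1 _ zero = z≤n
desFrom-take-≤1 {xs = []} _ (suc q) = z≤n
desFrom-take-≤1 {x = x} {xs = y ∷ []} _ (suc q)
  rewrite take-[] {A = ℕ} q | +-identityʳ (lt (toℕ y) (toℕ x)) = lt≤1 (toℕ y) (toℕ x)
desFrom-take-≤1 {xs = y ∷ z ∷ xs} inc (suc q)
  rewrite lt-≥ (<⇒≤ (increasingButLast-head inc)) = desFrom-take-≤1 (increasingButLast-tail inc) q

increasingButLast⇒ballot : ∀ {m n} (σ : Vec (Fin m) (3 + n)) → IncreasingButLast σ →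
                           ∀ p → des (take p (toList σ)) ≤ asc (take p (toList σ))
increasingButLast⇒ballot _ _ zero = z≤n
increasingButLast⇒ballot (_ ∷ _) _ (suc zero) = z≤n
increasingButLast⇒ballot (_ ∷ _ ∷ _ ∷ _) inc (suc (suc q))
  rewrite lt-≥ (<⇒≤ (increasingButLast-head inc)) | lt-< (increasingButLast-head inc) =
  ≤-trans (desFrom-take-≤1 (increasingButLast-tail inc) q) (s≤s z≤n)

lookup₃-strictMono : ∀ {a ℓ} {A : Set a} {_≺_ : Rel A ℓ} → Transitive _≺_ → ∀ {x y z} →
                     x ≺ y → y ≺ z → lookup (x ∷ y ∷ z ∷ []) Preserves _<ᶠ_ ⟶ _≺_
lookup₃-strictMono _       x≺y _   {0F} {1F} _ = x≺y
lookup₃-strictMono ≺-trans x≺y y≺z {0F} {2F} _ = ≺-trans x≺y y≺z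
lookup₃-strictMono _       _   y≺z {1F} {2F} _ = y≺z
lookup₃-strictMono _ _ _ {0F} {0F} ()
lookup₃-strictMono _ _ _ {1F} {0F} ()
lookup₃-strictMono _ _ _ {1F} {1F} (s≤s ())
lookup₃-strictMono _ _ _ {2F} {0F} ()
lookup₃-strictMono _ _ _ {2F} {1F} (s≤s ())
lookup₃-strictMono _ _ _ {2F} {2F} (s≤s (s≤s ()))

strictMono⇒reflects< : ∀ {k n} {w : Fin k → Fin n} → w Preserves _<ᶠ_ ⟶ _<ᶠ_ →
                       ∀ {a b} → w a <ᶠ w b → a <ᶠ b
strictMono⇒reflects< w-mono {a} {b} wa<wb with Finₚ.<-cmp a b
... | tri< a<b _ _ = a<b
... | tri≈ _ refl _ = ⊥-elim (<-irrefl refl wa<wb)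
... | tri> _ _ b<a = ⊥-elim (<-asym wa<wb (w-mono b<a))

-- A strictly increasing w preserves and reflects order, so σ ∘ c = w ∘ π makes the occurrence
-- σ ∘ c order-isomorphic to π.
factorisation⇒contains : ∀ {n k} {σ : Vec (Fin n) n} {π : Vec (Fin k) k} (c w : Fin k → Fin n) →
                         c Preserves _<ᶠ_ ⟶ _<ᶠ_ → w Preserves _<ᶠ_ ⟶ _<ᶠ_ →
                         (∀ a → lookup σ (c a) ≡ w (lookup π a)) → Contains σ π
factorisation⇒contains {σ = σ} {π} c w c-mono w-mono σc≡wπ =
  c , (λ _ _ → c-mono) , λ a b → mk⇔ (reflects a b) (preserves a b)
  where
  preserves : ∀ a b → lookup π a <ᶠ lookup π b → lookup σ (c a) <ᶠ lookup σ (c b)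
  preserves a b πa<πb = subst₂ _<ᶠ_ (sym (σc≡wπ a)) (sym (σc≡wπ b)) (w-mono πa<πb)
  reflects : ∀ a b → lookup σ (c a) <ᶠ lookup σ (c b) → lookup π a <ᶠ lookup π b
  reflects a b σca<σcb =
    strictMono⇒reflects< w-mono (subst₂ _<ᶠ_ (σc≡wπ a) (σc≡wπ b) σca<σcb)

increasingButLast⇒avoids : ∀ {n k} (σ : Vec (Fin n) n) (π : Vec (Fin (3 + k)) (3 + k)) →
                           IncreasingButLast σ → lookup π 1F <ᶠ lookup π 0F →
                           Avoids σ π
increasingButLast⇒avoids _ _ inc π₁<π₀ (c , c-mono , c-iso) =
  Finₚ.<-asym π₁<π₀ (Equivalence.to (c-iso 0F 1F)
    (inc (c-mono 0F 1F (s≤s z≤n)) (c-mono 1F 2F (s≤s (s≤s z≤n)))))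

triple⇒contains : ∀ {n} (σ : Vec (Fin n) n) (π : Vec (Fin 3) 3) {i j l x y z : Fin n} →
            i <ᶠ j → j <ᶠ l → x <ᶠ y → y <ᶠ z →
            (∀ a → lookup σ (lookup (i ∷ j ∷ l ∷ []) a) ≡
                   lookup (x ∷ y ∷ z ∷ []) (lookup π a)) →
            Contains σ π
triple⇒contains σ π {i} {j} {l} {x} {y} {z} i<j j<l x<y y<z =
  factorisation⇒contains {σ = σ} {π = π} (lookup (i ∷ j ∷ l ∷ [])) (lookup (x ∷ y ∷ z ∷ []))
    (lookup₃-strictMono {_≺_ = _<ᶠ_} Finₚ.<-trans i<j j<l)
    (lookup₃-strictMono {_≺_ = _<ᶠ_} Finₚ.<-trans x<y y<z)

avoids-213-312-321⇒increasingButLast : ∀ {n} {σ : Vec (Fin n) n} → IsPerm σ →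
  Avoids σ p213 → Avoids σ p312 → Avoids σ p321 → IncreasingButLast σ
avoids-213-312-321⇒increasingButLast {σ = σ} perm a213 a312 a321 {i} {j} {l} i<j j<l
  with Finₚ.<-cmp (lookup σ i) (lookup σ j)
... | tri< σi<σj _ _ = σi<σj
... | tri≈ _ σi≡σj _ = ⊥-elim (Finₚ.<-irrefl (perm i j σi≡σj) i<j)
... | tri> _ _ σj<σi with Finₚ.<-cmp (lookup σ l) (lookup σ j)
...   | tri< σl<σj _ _ = ⊥-elim (a321 (triple⇒contains σ p321 i<j j<l σl<σj σj<σi
          λ { 0F → refl ; 1F → refl ; 2F → refl }))
...   | tri≈ _ σl≡σj _ = ⊥-elim (Finₚ.<-irrefl (perm j l (sym σl≡σj)) j<l)
...   | tri> _ _ σj<σl with Finₚ.<-cmp (lookup σ l) (lookup σ i)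
...     | tri< σl<σi _ _ = ⊥-elim (a312 (triple⇒contains σ p312 i<j j<l σj<σl σl<σi
          λ { 0F → refl ; 1F → refl ; 2F → refl }))
...     | tri≈ _ σl≡σi _ = ⊥-elim (Finₚ.<-irrefl (perm i l (sym σl≡σi)) (Finₚ.<-trans i<j j<l))
...     | tri> _ _ σi<σl = ⊥-elim (a213 (triple⇒contains σ p213 i<j j<l σj<σi σi<σl
          λ { 0F → refl ; 1F → refl ; 2F → refl }))

-- punch k enumerates ℕ ∖ {k} increasingly (the ℕ analogue of Fin.punchIn).
punch : ℕ → ℕ → ℕ
punch k p with p <? k
... | yes _ = p
... | no _  = suc p

punch-≤ : ∀ k p → punch k p ≤ suc p
punch-≤ k p with p <? k
... | yes _ = n≤1+n p
... | no _  = ≤-refl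

punch-≢ : ∀ k p → punch k p ≢ k
punch-≢ k p with p <? k
... | yes p<k = λ p≡k → <-irrefl p≡k p<k
... | no p≮k  = λ 1+p≡k → p≮k (≤-reflexive 1+p≡k)

punch-strictMono : ∀ k → punch k Preserves _<_ ⟶ _<_
punch-strictMono k {i} {j} i<j with i <? k | j <? k
... | yes _   | yes _   = i<j
... | yes _   | no _    = m<n⇒m<1+n i<j
... | no i≮k | yes j<k = ⊥-elim (i≮k (<-trans i<j j<k))
... | no _    | no _    = s≤s i<j

punch-injective : ∀ k {i j} → punch k i ≡ punch k j → i ≡ j
punch-injective k {i} {j} e with <-cmp i j
... | tri< i<j _ _ = ⊥-elim (<-irrefl e (punch-strictMono k i<j))
... | tri≈ _ i≡j _ = i≡j
... | tri> _ _ j<i = ⊥-elim (<-irrefl (sym e) (punch-strictMono k j<i))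

-- The bounds i ≤ f i ≤ i + 1 come from counting the gaps before and after position i;
-- either wrong choice of f i would force some f j to equal K.
module _ {m K : ℕ} (f : ℕ → ℕ) (K≤m : K ≤ m)
         (f-< : ∀ {i j} → i < j → j < m → f i < f j)
         (f-≤ : ∀ {i} → i < m → f i ≤ m)
         (f-≢ : ∀ {i} → i < m → f i ≢ K) where

  private
    spread : ∀ i d → i + d < m → f i + d ≤ f (i + d)
    spread i zero _ rewrite +-identityʳ i | +-identityʳ (f i) = ≤-refl
    spread i (suc d) i+1+d<m rewrite +-suc i d | +-suc (f i) d =
      ≤-<-trans (spread i d (<-trans (n<1+n (i + d)) i+1+d<m)) (f-< (n<1+n (i + d)) i+1+d<m)

    ≤f : ∀ {i} → i < m → i ≤ f i
    ≤f {i} i<m = ≤-trans (m≤n+m i (f 0)) (spread 0 i i<m)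

    f≤1+ : ∀ {i} → i < m → f i ≤ suc i
    f≤1+ {i} i<m = +-cancelʳ-≤ d (f i) (suc i) (begin
        f i + d     ≤⟨ spread i d i+d<m ⟩
        f (i + d)   ≤⟨ f-≤ i+d<m ⟩
        m           ≡⟨ m+[n∸m]≡n i<m ⟨
        suc i + d   ∎)
      where
      open ≤-Reasoning
      d : ℕ
      d = m ∸ suc i
      i+d<m : i + d < m
      i+d<m = ≤-reflexive (m+[n∸m]≡n i<m)

    below-K : ∀ {i} → i < m → i < K → f i ≡ i
    below-K {i} i<m i<K with m≤n⇒m<n∨m≡n (≤f i<m)
    ... | inj₂ i≡fi = sym i≡fi
    ... | inj₁ i<fi = ⊥-elim (f-≢ j<m (≤-antisym
          (begin f (i + d) ≤⟨ f≤1+ j<m ⟩ suc i + d ≡⟨ 1+i+d≡K ⟩ K ∎)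
          (begin
             K           ≡⟨ 1+i+d≡K ⟨
             suc i + d   ≤⟨ +-monoˡ-≤ d i<fi ⟩
             f i + d     ≤⟨ spread i d j<m ⟩
             f (i + d)   ∎)))
      where
      open ≤-Reasoning
      d : ℕ
      d = K ∸ suc i
      1+i+d≡K : suc i + d ≡ K
      1+i+d≡K = m+[n∸m]≡n i<K
      j<m : i + d < m
      j<m = ≤-trans (≤-reflexive 1+i+d≡K) K≤m

    above-K : ∀ {i} → i < m → K ≤ i → f i ≡ suc i
    above-K {i} i<m K≤i with m≤n⇒m<n∨m≡n (f≤1+ i<m)
    ... | inj₂ fi≡1+i = fi≡1+i
    ... | inj₁ fi<1+i = ⊥-elim (f-≢ K<m (≤-antisym fK≤K (≤f K<m)))
      where
      open ≤-Reasoning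
      d : ℕ
      d = i ∸ K
      K+d≡i : K + d ≡ i
      K+d≡i = m+[n∸m]≡n K≤i
      K<m : K < m
      K<m = ≤-<-trans K≤i i<m
      fK≤K : f K ≤ K
      fK≤K = +-cancelʳ-≤ d (f K) K (begin
        f K + d     ≤⟨ spread K d (subst (_< m) (sym K+d≡i) i<m) ⟩
        f (K + d)   ≡⟨ cong f K+d≡i ⟩
        f i         ≤⟨ ≤-pred fi<1+i ⟩
        i           ≡⟨ K+d≡i ⟨
        K + d       ∎)

  strictMono-avoiding⇒punch : ∀ {i} → i < m → f i ≡ punch K i
  strictMono-avoiding⇒punch {i} i<m with i <? K
  ... | yes i<K = below-K i<m i<K
  ... | no i≮K  = above-K i<m (≮⇒≥ i≮K)

-- The permutation listing {0,…,m} ∖ {k} increasingly, followed by k.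
moveToEnd-entry : ∀ {m} → Fin (suc m) → Fin (suc m) → Fin (suc m)
moveToEnd-entry {m} k p with toℕ p <? m
... | yes p<m = fromℕ< (s≤s (≤-trans (punch-≤ (toℕ k) (toℕ p)) p<m))
... | no _    = k

moveToEnd : ∀ {m} → Fin (suc m) → Vec (Fin (suc m)) (suc m)
moveToEnd k = tabulate (moveToEnd-entry k)

lookup-moveToEnd-< : ∀ {m} (k p : Fin (suc m)) → toℕ p < m →
                     toℕ (lookup (moveToEnd k) p) ≡ punch (toℕ k) (toℕ p)
lookup-moveToEnd-< {m} k p p<m rewrite lookup∘tabulate (moveToEnd-entry k) p with toℕ p <? m
... | yes _    = Finₚ.toℕ-fromℕ< _
... | no p≮m = ⊥-elim (p≮m p<m)

lookup-moveToEnd-last : ∀ {m} (k : Fin (suc m)) → lookup (moveToEnd k) (fromℕ m) ≡ k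
lookup-moveToEnd-last {m} k rewrite lookup∘tabulate (moveToEnd-entry k) (fromℕ m)
  with toℕ (fromℕ m) <? m
... | yes m<m = ⊥-elim (<-irrefl (Finₚ.toℕ-fromℕ m) m<m)
... | no _    = refl

toℕ<pred⊎≡fromℕ : ∀ {m} (p : Fin (suc m)) → toℕ p < m ⊎ p ≡ fromℕ m
toℕ<pred⊎≡fromℕ {m} p with m≤n⇒m<n∨m≡n (Finₚ.toℕ≤pred[n] p)
... | inj₁ p<m = inj₁ p<m
... | inj₂ p≡m = inj₂ (Finₚ.toℕ-injective (trans p≡m (sym (Finₚ.toℕ-fromℕ m))))

lookup-moveToEnd-<-≢ : ∀ {m} (k p : Fin (suc m)) → toℕ p < m → lookup (moveToEnd k) p ≢ k
lookup-moveToEnd-<-≢ k p p<m σp≡k =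
  punch-≢ (toℕ k) (toℕ p) (trans (sym (lookup-moveToEnd-< k p p<m)) (cong toℕ σp≡k))

moveToEnd-isPerm : ∀ {m} (k : Fin (suc m)) → IsPerm (moveToEnd k)
moveToEnd-isPerm k i j σi≡σj with toℕ<pred⊎≡fromℕ i | toℕ<pred⊎≡fromℕ j
... | inj₁ i<m  | inj₁ j<m  = Finₚ.toℕ-injective (punch-injective (toℕ k) (begin
    punch (toℕ k) (toℕ i)         ≡⟨ lookup-moveToEnd-< k i i<m ⟨
    toℕ (lookup (moveToEnd k) i)  ≡⟨ cong toℕ σi≡σj ⟩
    toℕ (lookup (moveToEnd k) j)  ≡⟨ lookup-moveToEnd-< k j j<m ⟩
    punch (toℕ k) (toℕ j)         ∎))
  where open ≡-Reasoning
... | inj₁ i<m  | inj₂ refl =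
  ⊥-elim (lookup-moveToEnd-<-≢ k i i<m (trans σi≡σj (lookup-moveToEnd-last k)))
... | inj₂ refl | inj₁ j<m  =
  ⊥-elim (lookup-moveToEnd-<-≢ k j j<m (trans (sym σi≡σj) (lookup-moveToEnd-last k)))
... | inj₂ refl | inj₂ refl = refl

moveToEnd-increasingButLast : ∀ {m} (k : Fin (suc m)) → IncreasingButLast (moveToEnd k)
moveToEnd-increasingButLast {m} k {i} {j} {l} i<j j<l =
  subst₂ _<_ (sym (lookup-moveToEnd-< k i (<-trans i<j j<m))) (sym (lookup-moveToEnd-< k j j<m))
    (punch-strictMono (toℕ k) i<j)
  where
  j<m : toℕ j < m
  j<m = <-≤-trans j<l (Finₚ.toℕ≤pred[n] l)

moveToEnd-injective : ∀ {m} {k k′ : Fin (suc m)} → moveToEnd k ≡ moveToEnd k′ → k ≡ k′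
moveToEnd-injective {m} {k} {k′} e = begin
  k                                ≡⟨ lookup-moveToEnd-last k ⟨
  lookup (moveToEnd k) (fromℕ m)   ≡⟨ cong (λ σ → lookup σ (fromℕ m)) e ⟩
  lookup (moveToEnd k′) (fromℕ m)  ≡⟨ lookup-moveToEnd-last k′ ⟩
  k′                               ∎
  where open ≡-Reasoning

-- Saturating ℕ → Fin (suc m), to read a vector as a total sequence ℕ → ℕ.
clamp : ∀ m → ℕ → Fin (suc m)
clamp m       zero    = Fin.zero
clamp zero    (suc i) = Fin.zero
clamp (suc m) (suc i) = Fin.suc (clamp m i)

toℕ-clamp : ∀ {m i} → i ≤ m → toℕ (clamp m i) ≡ i
toℕ-clamp {m}     {zero}  _         = refl
toℕ-clamp {suc m} {suc i} (s≤s i≤m) = cong suc (toℕ-clamp i≤m)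

clamp-toℕ : ∀ {m} (p : Fin (suc m)) → clamp m (toℕ p) ≡ p
clamp-toℕ p = Finₚ.toℕ-injective (toℕ-clamp (Finₚ.toℕ≤pred[n] p))

clamp-< : ∀ {m i j} → i < j → j ≤ m → clamp m i <ᶠ clamp m j
clamp-< i<j j≤m =
  subst₂ _<_ (sym (toℕ-clamp (<⇒≤ (<-≤-trans i<j j≤m)))) (sym (toℕ-clamp j≤m)) i<j

increasingButLast⇒≡moveToEnd : ∀ {m} {σ : Vec (Fin (suc m)) (suc m)} →
                               IsPerm σ → IncreasingButLast σ → σ ≡ moveToEnd (lookup σ (fromℕ m))
increasingButLast⇒≡moveToEnd {m} {σ} perm inc = begin
  σ                                ≡⟨ tabulate∘lookup σ ⟨
  tabulate (lookup σ)              ≡⟨ tabulate-cong σ≗moveToEnd ⟩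
  tabulate (lookup (moveToEnd k))  ≡⟨ tabulate∘lookup (moveToEnd k) ⟩
  moveToEnd k                      ∎
  where
  open ≡-Reasoning
  k : Fin (suc m)
  k = lookup σ (fromℕ m)
  f : ℕ → ℕ
  f i = toℕ (lookup σ (clamp m i))
  f-≢ : ∀ {i} → i < m → f i ≢ toℕ k
  f-≢ {i} i<m fi≡k = <-irrefl (begin
    i                   ≡⟨ toℕ-clamp (<⇒≤ i<m) ⟨
    toℕ (clamp m i)     ≡⟨ cong toℕ (perm _ _ (Finₚ.toℕ-injective fi≡k)) ⟩
    toℕ (fromℕ m)       ≡⟨ Finₚ.toℕ-fromℕ m ⟩
    m                   ∎) i<m
  f≡punch : ∀ {i} → i < m → f i ≡ punch (toℕ k) i
  f≡punch = strictMono-avoiding⇒punch f (Finₚ.toℕ≤pred[n] k)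
    (λ i<j j<m → inc (clamp-< i<j (<⇒≤ j<m)) (clamp-< j<m ≤-refl))
    (λ _ → Finₚ.toℕ≤pred[n] _) f-≢
  σ≗moveToEnd : ∀ p → lookup σ p ≡ lookup (moveToEnd k) p
  σ≗moveToEnd p with toℕ<pred⊎≡fromℕ p
  ... | inj₂ refl = sym (lookup-moveToEnd-last k)
  ... | inj₁ p<m  = Finₚ.toℕ-injective (begin
    toℕ (lookup σ p)               ≡⟨ cong (toℕ ∘ lookup σ) (clamp-toℕ p) ⟨
    f (toℕ p)                      ≡⟨ f≡punch p<m ⟩
    punch (toℕ k) (toℕ p)          ≡⟨ lookup-moveToEnd-< k p p<m ⟨
    toℕ (lookup (moveToEnd k) p)   ∎)

B⇒≡moveToEnd : ∀ {m} {σ : Vec (Fin (suc m)) (suc m)} →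
               InB (suc m) σ → σ ≡ moveToEnd (lookup σ (fromℕ m))
B⇒≡moveToEnd {σ = σ} (perm , _ , a213 , a312 , a321) = increasingButLast⇒≡moveToEnd perm
  (avoids-213-312-321⇒increasingButLast {σ = σ} perm a213 a312 a321)

moveToEnd∈B : ∀ {m} (k : Fin (3 + m)) → InB (3 + m) (moveToEnd k)
moveToEnd∈B {m} k = moveToEnd-isPerm k , increasingButLast⇒ballot σ inc ,
  increasingButLast⇒avoids σ p213 inc (s≤s z≤n) , increasingButLast⇒avoids σ p312 inc (s≤s z≤n) ,
  increasingButLast⇒avoids σ p321 inc (s≤s (s≤s z≤n))
  where
  σ : Vec (Fin (3 + m)) (3 + m)
  σ = moveToEnd k
  inc : IncreasingButLast σ
  inc = moveToEnd-increasingButLast k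

theorem4p7 : ∀ (n : ℕ) → 3 ≤ n → HasCard (InB n) n
theorem4p7 0 ()
theorem4p7 1 (s≤s ())
theorem4p7 2 (s≤s (s≤s ()))
theorem4p7 (suc (suc (suc m))) _ =
  map moveToEnd (allFin n) , map⁺ moveToEnd-injective (allFin⁺ n) ,
  trans (length-map moveToEnd (allFin n)) (length-tabulate (λ p → p)) , λ σ → mk⇔ (∈⇒B σ) (B⇒∈ σ)
  where
  n : ℕ
  n = 3 + m
  ∈⇒B : ∀ σ → σ ∈ map moveToEnd (allFin n) → InB n σ
  ∈⇒B σ σ∈ with ∈-map⁻ moveToEnd σ∈
  ... | k , _ , refl = moveToEnd∈B k
  B⇒∈ : ∀ σ → InB n σ → σ ∈ map moveToEnd (allFin n)
  B⇒∈ σ σ∈B = subst (_∈ map moveToEnd (allFin n)) (sym (B⇒≡moveToEnd σ∈B))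
                    (∈-map⁺ moveToEnd (∈-allFin _))
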